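{- For all $n,k,d_2\in\mathbb{N}$ such that $k\le n-d_2$, \[\frac{\binom{n-k-1}{d_2-1}}{\binom{n-1}{d_2-1}}\le\left(\frac{\binom{2n-k-1}{d_2-1}}{\binom{2n-1}{d_2-1}}\right)^2.\] -}

module Defs where

-- Write a = n − k − 1, y = 2n − 1, e = d₂ − 1, so that a + k = n − 1 and 2(a + k) ≤ y.
-- By absorption, C(m, d + 1)(d + 1) = C(m, d)(m − d), raising e from d to d + 1
-- multiplies the left side by (a − d)(y − d)² and the right side by (y − k − d)²(a + k − d)
-- (after clearing (d + 1)³).  With p = a − d and q = y − k − d these factors are p(q + k)²
-- and q²(p + k), and q ≥ 2p + k makes the second one the larger; induction on e finishes.

module Submission where

open import Defs
open import Data.Nat using (ℕ; _≤_; _*_; _∸_; _+_)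
open import Data.Nat.Combinatorics using (_C_)
open import Data.Nat using (zero; suc; _<?_; s≤s)
open import Data.Nat.Properties
open import Data.Nat.Combinatorics using (nC1≡n; k>n⇒nCk≡0; nCk+nC[k+1]≡[n+1]C[k+1])
open import Data.Nat.Tactic.RingSolver using (solve-∀)
open import Data.Product using (_,_)
open import Relation.Nullary using (yes; no)
open import Relation.Binary.PropositionalEquality

nC[k+1]*[k+1]≡nCk*[n∸k] : ∀ n k → (n C suc k) * suc k ≡ (n C k) * (n ∸ k)
nC[k+1]*[k+1]≡nCk*[n∸k] zero    k       = sym (trans (cong ((0 C k) *_) (0∸n≡0 k)) (*-zeroʳ (0 C k)))
nC[k+1]*[k+1]≡nCk*[n∸k] (suc n) zero    = trans (*-identityʳ (suc n C 1)) (trans (nC1≡n (suc n)) (sym (*-identityˡ (suc n))))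
nC[k+1]*[k+1]≡nCk*[n∸k] (suc n) (suc k) = begin
  (suc n C suc (suc k)) * suc (suc k)       ≡⟨ cong (_* suc (suc k)) (nCk+nC[k+1]≡[n+1]C[k+1] n (suc k)) ⟨
  (c₁ + c₂) * suc (suc k)                   ≡⟨ *-distribʳ-+ (suc (suc k)) c₁ c₂ ⟩
  c₁ * suc (suc k) + c₂ * suc (suc k)       ≡⟨ cong (c₁ * suc (suc k) +_) (nC[k+1]*[k+1]≡nCk*[n∸k] n (suc k)) ⟩
  c₁ * suc (suc k) + c₁ * (n ∸ suc k)       ≡⟨ move-suc c₁ (suc k) (n ∸ suc k) ⟩
  c₁ * suc k + c₁ * suc (n ∸ suc k)         ≡⟨ cong₂ _+_ (nC[k+1]*[k+1]≡nCk*[n∸k] n k) c₁*[1+n∸[k+1]]≡c₁*[n∸k] ⟩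
  c₀ * (n ∸ k) + c₁ * (n ∸ k)               ≡⟨ *-distribʳ-+ (n ∸ k) c₀ c₁ ⟨
  (c₀ + c₁) * (n ∸ k)                       ≡⟨ cong (_* (n ∸ k)) (nCk+nC[k+1]≡[n+1]C[k+1] n k) ⟩
  (suc n C suc k) * (n ∸ k)                ∎
  where
  open ≡-Reasoning
  c₀ c₁ c₂ : ℕ
  c₀ = n C k
  c₁ = n C suc k
  c₂ = n C suc (suc k)
  move-suc : ∀ c x y → c * suc x + c * y ≡ c * x + c * suc y
  move-suc = solve-∀
  -- if n ≤ k the truncated subtractions disagree, but then c₁ = 0
  c₁*[1+n∸[k+1]]≡c₁*[n∸k] : c₁ * suc (n ∸ suc k) ≡ c₁ * (n ∸ k)
  c₁*[1+n∸[k+1]]≡c₁*[n∸k] with k <? n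
  ... | yes k<n = cong (c₁ *_) (sym (+-∸-assoc 1 k<n))
  ... | no  k≮n rewrite k>n⇒nCk≡0 (s≤s (≮⇒≥ k≮n)) = refl

m∸n∸o≡m∸o∸n : ∀ m n o → m ∸ n ∸ o ≡ m ∸ o ∸ n
m∸n∸o≡m∸o∸n m n o = begin
  m ∸ n ∸ o     ≡⟨ ∸-+-assoc m n o ⟩
  m ∸ (n + o)   ≡⟨ cong (m ∸_) (+-comm n o) ⟩
  m ∸ (o + n)   ≡⟨ ∸-+-assoc m o n ⟨
  m ∸ o ∸ n     ∎
  where open ≡-Reasoning

p[q+k]²≤q²[p+k] : ∀ p q k → 2 * p + k ≤ q → p * ((q + k) * (q + k)) ≤ (q * q) * (p + k)
p[q+k]²≤q²[p+k] p q k 2p+k≤q with m≤n⇒∃[o]m+o≡n 2p+k≤q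
... | t , refl = begin
  p * ((q + k) * (q + k))                 ≤⟨ m≤m+n _ _ ⟩
  p * ((q + k) * (q + k)) + k * slack     ≡⟨ expand p k t ⟩
  (q * q) * (p + k)                       ∎
  where
  open ≤-Reasoning
  slack : ℕ
  slack = p * k + 2 * p * t + k * k + 2 * k * t + t * t
  -- q = 2p + k + t and q²(p + k) − p(q + k)² = k(q(q − 2p) − pk) = k · slack
  expand : ∀ p k t → let q = 2 * p + k + t in
           p * ((q + k) * (q + k)) + k * (p * k + 2 * p * t + k * k + 2 * k * t + t * t) ≡ (q * q) * (p + k)
  expand = solve-∀

[a∸d][y∸d]²≤[y∸k∸d]²[a+k∸d] : ∀ a k y d → d ≤ a → 2 * (a + k) ≤ y →
  (a ∸ d) * ((y ∸ d) * (y ∸ d)) ≤ ((y ∸ k ∸ d) * (y ∸ k ∸ d)) * (a + k ∸ d)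
[a∸d][y∸d]²≤[y∸k∸d]²[a+k∸d] a k y d d≤a 2[a+k]≤y = begin
  p * ((y ∸ d) * (y ∸ d))   ≡⟨ cong (λ x → p * (x * x)) y∸d≡q+k ⟩
  p * ((q + k) * (q + k))   ≤⟨ p[q+k]²≤q²[p+k] p q k 2p+k≤q ⟩
  (q * q) * (p + k)         ≡⟨ cong ((q * q) *_) (+-∸-comm k d≤a) ⟨
  (q * q) * (a + k ∸ d)     ∎
  where
  open ≤-Reasoning
  p q : ℕ
  p = a ∸ d
  q = y ∸ k ∸ d

  d+k≤y : d + k ≤ y
  d+k≤y = begin
    d + k         ≤⟨ +-monoˡ-≤ k d≤a ⟩
    a + k         ≤⟨ m≤n*m (a + k) 2 ⟩
    2 * (a + k)   ≤⟨ 2[a+k]≤y ⟩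
    y             ∎

  y∸d≡q+k : y ∸ d ≡ q + k
  y∸d≡q+k = begin-equality
    y ∸ d           ≡⟨ cong (_∸ d) (m∸n+n≡m (m+n≤o⇒n≤o d d+k≤y)) ⟨
    (y ∸ k + k) ∸ d ≡⟨ +-∸-comm k (m+n≤o⇒m≤o∸n d d+k≤y) ⟩
    q + k           ∎

  regroup : ∀ p k d → 2 * p + k + (k + d) + d ≡ 2 * (p + d + k)
  regroup = solve-∀

  2p+k≤q : 2 * p + k ≤ q
  2p+k≤q = subst (2 * p + k ≤_) (sym (∸-+-assoc y k d)) (m+n≤o⇒m≤o∸n (2 * p + k) (begin
    2 * p + k + (k + d)       ≤⟨ m≤m+n _ d ⟩
    2 * p + k + (k + d) + d   ≡⟨ regroup p k d ⟩
    2 * (p + d + k)           ≡⟨ cong (λ x → 2 * (x + k)) (m∸n+n≡m d≤a) ⟩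
    2 * (a + k)               ≤⟨ 2[a+k]≤y ⟩
    y                         ∎))

C-ratio-≤-square-ratio : ∀ a k y e → e ≤ a → 2 * (a + k) ≤ y →
  (a C e) * ((y C e) * (y C e)) ≤ (((y ∸ k) C e) * ((y ∸ k) C e)) * ((a + k) C e)
C-ratio-≤-square-ratio a k y zero    _   _        = ≤-refl
C-ratio-≤-square-ratio a k y (suc d) d<a 2[a+k]≤y = *-cancelʳ-≤ _ _ (e * (e * e)) (begin
  (α′ * (β′ * β′)) * (e * (e * e))                ≡⟨ interchangeˡ α′ β′ e e ⟨
  (α′ * e) * ((β′ * e) * (β′ * e))                ≡⟨ cong₂ (λ u v → u * (v * v)) (absorb a) (absorb y) ⟩
  (α * (a ∸ d)) * ((β * (y ∸ d)) * (β * (y ∸ d))) ≡⟨ interchangeˡ α β (a ∸ d) (y ∸ d) ⟩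
  (α * (β * β)) * ((a ∸ d) * ((y ∸ d) * (y ∸ d))) ≤⟨ *-mono-≤ ih step ⟩
  ((γ * γ) * δ) * ((r * r) * s)                   ≡⟨ interchangeʳ γ δ r s ⟩
  ((γ * r) * (γ * r)) * (δ * s)                   ≡⟨ cong₂ (λ u v → (u * u) * v) (absorb (y ∸ k)) (absorb (a + k)) ⟨
  ((γ′ * e) * (γ′ * e)) * (δ′ * e)                ≡⟨ interchangeʳ γ′ δ′ e e ⟨
  ((γ′ * γ′) * δ′) * ((e * e) * e)                ≡⟨ cong (((γ′ * γ′) * δ′) *_) (*-assoc e e e) ⟩
  ((γ′ * γ′) * δ′) * (e * (e * e))                ∎)
  where
  open ≤-Reasoning
  e r s α β γ δ α′ β′ γ′ δ′ : ℕ
  e = suc d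
  r = y ∸ k ∸ d
  s = a + k ∸ d
  α = a C d
  β = y C d
  γ = (y ∸ k) C d
  δ = (a + k) C d
  α′ = a C e
  β′ = y C e
  γ′ = (y ∸ k) C e
  δ′ = (a + k) C e

  absorb : ∀ n → (n C e) * e ≡ (n C d) * (n ∸ d)
  absorb n = nC[k+1]*[k+1]≡nCk*[n∸k] n d

  ih : α * (β * β) ≤ (γ * γ) * δ
  ih = C-ratio-≤-square-ratio a k y d (<⇒≤ d<a) 2[a+k]≤y

  step : (a ∸ d) * ((y ∸ d) * (y ∸ d)) ≤ (r * r) * s
  step = [a∸d][y∸d]²≤[y∸k∸d]²[a+k∸d] a k y d (<⇒≤ d<a) 2[a+k]≤y

  interchangeˡ : ∀ x y u v → (x * u) * ((y * v) * (y * v)) ≡ (x * (y * y)) * (u * (v * v))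
  interchangeˡ = solve-∀
  interchangeʳ : ∀ x y u v → ((x * x) * y) * ((u * u) * v) ≡ ((x * u) * (x * u)) * (y * v)
  interchangeʳ = solve-∀

lemma6p9 : (n k d₂ : ℕ) → d₂ ≤ n → k ≤ n ∸ d₂ →
    ((n ∸ k ∸ 1) C (d₂ ∸ 1)) * (((2 * n ∸ 1) C (d₂ ∸ 1)) * ((2 * n ∸ 1) C (d₂ ∸ 1)))
      ≤ (((2 * n ∸ k ∸ 1) C (d₂ ∸ 1)) * ((2 * n ∸ k ∸ 1) C (d₂ ∸ 1))) * ((n ∸ 1) C (d₂ ∸ 1))
lemma6p9 n       k zero    _         _      = ≤-refl
lemma6p9 (suc x) k (suc e) (s≤s e≤x) k≤x∸e
  rewrite m∸n∸o≡m∸o∸n (suc x) k 1 | m∸n∸o≡m∸o∸n (2 * suc x) k 1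
  = subst (λ m → ((x ∸ k) C e) * ((y C e) * (y C e)) ≤ (((y ∸ k) C e) * ((y ∸ k) C e)) * (m C e))
      x∸k+k≡x (C-ratio-≤-square-ratio (x ∸ k) k y e e≤x∸k 2[x∸k+k]≤y)
  where
  k+e≤x : k + e ≤ x
  k+e≤x = m≤o∸n⇒m+n≤o k e≤x k≤x∸e
  x∸k+k≡x : x ∸ k + k ≡ x
  x∸k+k≡x = m∸n+n≡m (m+n≤o⇒m≤o k k+e≤x)
  e≤x∸k : e ≤ x ∸ k
  e≤x∸k = m+n≤o⇒m≤o∸n e (subst (_≤ x) (+-comm k e) k+e≤x)
  y : ℕ
  y = 2 * suc x ∸ 1
  2[x∸k+k]≤y : 2 * (x ∸ k + k) ≤ y
  -- y reduces to x + suc (x + 0)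
  2[x∸k+k]≤y rewrite x∸k+k≡x = +-monoʳ-≤ x (n≤1+n (x + 0))
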